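{- Let $n\ge1$ and $t\ge0$. Every $\vec{\mathsf b}\in V_n$ can be written as a sum $\vec{\mathsf b}=\vec{\mathsf b}^{(1)}+\vec{\mathsf b}^{(2)}+\cdots+\vec{\mathsf b}^{(r)}$ (summed from left to right), where each $\vec{\mathsf b}^{(i)}$ is an irreducible element of $V_{n_i}$ and $n_1+\cdots+n_r=n$. Moreover, $\vec{\mathsf b}$ is $t$-$\mathsf{Pop}$-sortable in $V_n$ if and only if each irreducible component $\vec{\mathsf b}^{(i)}$ is $t$-$\mathsf{Pop}$-sortable in $V_{n_i}$.
   Context: For $m\ge1$, let $V_m=\mathrm{Vec}(\mathrm{E(NE)}^{m-1})$ be the set of integer vectors $(\mathsf b_0,\dots,\mathsf b_{2m-1})$ such that $\mathsf b_{2k+1}=k$ for $0\le k\le m-1$, $k\le\mathsf b_{2k}\le m-1$ for $0\le k\le m-1$, and whenever $\mathsf b_i=k$ we have $\mathsf b_j\le k$ for all $i+1\le j\le 2k+1$. Ordered componentwise, $V_m$ is a finite lattice (isomorphic to the Tamari lattice $\mathrm{Tam}_m$), whose minimum is $(0,0,1,1,\dots,m-1,m-1)$. An element $\vec{\mathsf b}\in V_m$ is irreducible if $\mathsf b_0=\mathsf b_{2m-1}$. For $\vec{\mathsf b}\in V_{m_1}$ and $\vec{\mathsf b}'\in V_{m_2}$, their sum is $\vec{\mathsf b}+\vec{\mathsf b}'=(\mathsf b_0,\dots,\mathsf b_{2m_1-1},\mathsf b'_0+m_1,\dots,\mathsf b'_{2m_2-1}+m_1)\in V_{m_1+m_2}$.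 For a finite lattice $M$, $\mathsf{Pop}_M(x)=\bigwedge(\{y\in M:y\lessdot x\}\cup\{x\})$, and $x$ is $t$-$\mathsf{Pop}$-sortable if $\mathsf{Pop}_M^t(x)$ is the minimum of $M$. -}

module Defs where

open import Data.Nat using (ℕ; zero; suc; _+_; _*_; _∸_; _≤_; _<_)
open import Data.List using (List; []; _∷_; _++_; map; length; foldl)
open import Data.List.Relation.Unary.All using (All)
open import Data.Product using (Σ; ∃; _×_; _,_; proj₁; proj₂)
open import Relation.Binary.PropositionalEquality using (_≡_)
open import Relation.Nullary using (¬_)
open import Function.Bundles using (_⇔_)

-- Entry i of a list (0-indexed); the default 0 is never used in the
-- definitions below, since all indices are bounded by the length 2m.
_!_ : List ℕ → ℕ → ℕ
[]       ! _     = 0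
(x ∷ xs) ! zero  = x
(x ∷ xs) ! suc i = xs ! i

-- The defining conditions of Vec(E(NE)^{m-1}) for a list b = (b_0,…,b_{2m-1}).
record IsV (m : ℕ) (b : List ℕ) : Set where
  field
    len  : length b ≡ 2 * m
    odd  : ∀ k → k < m → b ! (1 + 2 * k) ≡ k
    evenLo : ∀ k → k < m → k ≤ b ! (2 * k)
    evenHi : ∀ k → k < m → b ! (2 * k) ≤ m ∸ 1
    nest : ∀ i j → i < 2 * m → 1 + i ≤ j → j ≤ 1 + 2 * (b ! i) → b ! j ≤ b ! i

V : ℕ → Set
V m = Σ (List ℕ) (IsV m)

_≼_ : ∀ {m} → V m → V m → Set
_≼_ {m} x y = ∀ i → i < 2 * m → proj₁ x ! i ≤ proj₁ y ! i

_≺_ : ∀ {m} → V m → V m → Set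
x ≺ y = x ≼ y × ¬ (proj₁ x ≡ proj₁ y)

_⋖_ : ∀ {m} → V m → V m → Set
_⋖_ {m} y x = y ≺ x × ¬ (Σ (V m) λ z → y ≺ z × z ≺ x)

IsMinimum : ∀ m → V m → Set
IsMinimum m x = ∀ (y : V m) → x ≼ y

-- p = Pop(x) = ⋀ ({y : y ⋖ x} ∪ {x}) : p is the greatest lower bound of that set.
IsPop : ∀ m → V m → V m → Set
IsPop m x p =
  (p ≼ x × (∀ (y : V m) → y ⋖ x → p ≼ y)) ×
  (∀ (q : V m) → q ≼ x → (∀ (y : V m) → y ⋖ x → q ≼ y) → q ≼ p)

PopIter : ∀ m → ℕ → V m → V m → Set
PopIter m zero    x y = proj₁ x ≡ proj₁ y
PopIter m (suc t) x y = Σ (V m) λ z → IsPop m x z × PopIter m t z y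

PopSortable : ∀ m → ℕ → V m → Set
PopSortable m t x = Σ (V m) λ y → PopIter m t x y × IsMinimum m y

Irreducible : ∀ m → V m → Set
Irreducible m x = proj₁ x ! 0 ≡ proj₁ x ! (2 * m ∸ 1)

plus : ℕ → List ℕ → List ℕ → List ℕ
plus m₁ b b' = b ++ map (m₁ +_) b'

Component : Set
Component = Σ ℕ V

sumComponents : List Component → ℕ × List ℕ
sumComponents = foldl step (0 , [])
  where
  step : ℕ × List ℕ → Component → ℕ × List ℕ
  step (m , acc) (k , v) = (m + k , plus m acc (proj₁ v))

IrrDecomposition : ∀ n → V n → List Component → Set
IrrDecomposition n b cs =
  All (λ c → 1 ≤ proj₁ c × Irreducible (proj₁ c) (proj₂ c)) cs ×
  sumComponents cs ≡ (n , proj₁ b)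

-- The sum ⊕ is an order embedding of V m₁ × V m₂ into V (m₁ + m₂) whose image
-- is downward closed: below x ⊕ w the first m₁ blocks keep their values below
-- m₁, so every such element splits again at position 2 m₁.  Pop x only depends
-- on the lower covers of x and the elements below x, so it commutes with such
-- an embedding; in a product it acts coordinatewise, because a cover of a pair
-- moves exactly one coordinate.  Hence Pop^t (x ⊕ w) = Pop^t x ⊕ Pop^t w, and
-- this is the minimum (the staircase) iff both summands are.  An irreducible
-- decomposition of b is found by splitting off the first 1 + b₀ blocks, whose
-- values the nesting condition keeps at most b₀, and sortability is then
-- transported along the left-to-right sum.

module Submission where

open import Level using (_⊔_; 0ℓ)
open import Data.Nat.Base using (ℕ; zero; suc)
open import Data.Product using (Σ; ∃; ∃₂; _×_; _,_; proj₁; proj₂; uncurry)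
open import Data.Product.Relation.Binary.Pointwise.NonDependent using (×-poset)
open import Data.Sum using (_⊎_; inj₁; inj₂)
open import Data.Empty using (⊥-elim)
open import Function using (_∘_)
open import Function.Bundles using (_⇔_; mk⇔; module Equivalence)
open import Function.Properties.Equivalence using () renaming (trans to ⇔-trans; sym to ⇔-sym)
open import Data.Product.Function.NonDependent.Propositional using (_×-⇔_)
open import Relation.Nullary using (¬_; yes; no)
open import Relation.Binary.Bundles using (Poset)
open import Relation.Binary.Definitions using (Minimum; Decidable; _Respectsʳ_; _Respectsˡ_)

open Equivalence using (to; from)

-- Pop on a poset

module PopOperator {c ℓ} (P : Poset c ℓ ℓ) where
  private
    module P = Poset P
  open P using (Carrier; _≈_; _≤_)
  open import Relation.Binary.Properties.Poset P using (_<_; <-respʳ-≈; <-respˡ-≈; <-irrefl)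

  _⋖_ : Carrier → Carrier → Set (c ⊔ ℓ)
  y ⋖ x = y < x × ¬ (∃ λ z → y < z × z < x)

  LowerBound : Carrier → Carrier → Set _
  LowerBound x q = q ≤ x × (∀ y → y ⋖ x → q ≤ y)

  IsPop : Carrier → Carrier → Set _
  IsPop x p = LowerBound x p × (∀ q → q ≤ x → (∀ y → y ⋖ x → q ≤ y) → q ≤ p)

  Sortable : ℕ → Carrier → Set _
  Sortable zero    x = Minimum _≤_ x
  Sortable (suc t) x = ∃ λ z → IsPop x z × Sortable t z

  IsPop-greatest : ∀ {x p q} → IsPop x p → LowerBound x q → q ≤ p
  IsPop-greatest (_ , greatest) (q≤x , q≤covers) = greatest _ q≤x q≤covers

  ⋖-respʳ-≈ : _⋖_ Respectsʳ _≈_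
  ⋖-respʳ-≈ x≈x' (y<x , no-middle) =
    <-respʳ-≈ x≈x' y<x , λ (z , y<z , z<x') → no-middle (z , y<z , <-respʳ-≈ (P.Eq.sym x≈x') z<x')

  ⋖-respˡ-≈ : _⋖_ Respectsˡ _≈_
  ⋖-respˡ-≈ y≈y' (y<x , no-middle) =
    <-respˡ-≈ y≈y' y<x , λ (z , y'<z , z<x) → no-middle (z , <-respˡ-≈ (P.Eq.sym y≈y') y'<z , z<x)

  LowerBound-resp-≈ : ∀ {x x' q q'} → x ≈ x' → q ≈ q' → LowerBound x q → LowerBound x' q'
  LowerBound-resp-≈ x≈x' q≈q' (q≤x , q≤covers) =
    P.≤-respʳ-≈ x≈x' (P.≤-respˡ-≈ q≈q' q≤x) ,
    λ y y⋖x' → P.≤-respˡ-≈ q≈q' (q≤covers y (⋖-respʳ-≈ (P.Eq.sym x≈x') y⋖x'))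

  IsPop-resp-≈ : ∀ {x x' p p'} → x ≈ x' → p ≈ p' → IsPop x p → IsPop x' p'
  IsPop-resp-≈ x≈x' p≈p' pop@(lb , _) =
    LowerBound-resp-≈ x≈x' p≈p' lb ,
    λ q q≤x' q≤covers → P.≤-respʳ-≈ p≈p'
      (IsPop-greatest pop (LowerBound-resp-≈ (P.Eq.sym x≈x') P.Eq.refl (q≤x' , q≤covers)))

  Sortable-resp-≈ : ∀ t {x x'} → x ≈ x' → Sortable t x → Sortable t x'
  Sortable-resp-≈ zero    x≈x' min y = P.≤-respˡ-≈ x≈x' (min y)
  Sortable-resp-≈ (suc t) x≈x' (z , pop , s) = z , IsPop-resp-≈ x≈x' P.Eq.refl pop , s

  minimum-IsPop : ∀ {x} → Minimum _≤_ x → IsPop x x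
  minimum-IsPop min =
    (P.refl , λ y (y<x , _) → ⊥-elim (<-irrefl (P.antisym (proj₁ y<x) (min y)) y<x)) ,
    λ _ q≤x _ → q≤x

  minimum-Sortable : ∀ t {x} → Minimum _≤_ x → Sortable t x
  minimum-Sortable zero    min = min
  minimum-Sortable (suc t) min = _ , minimum-IsPop min , minimum-Sortable t min

module PopProduct {c ℓ} (P Q : Poset c ℓ ℓ)
  (_≟₁_ : Decidable (Poset._≈_ P)) (_≟₂_ : Decidable (Poset._≈_ Q)) where
  private
    module P = Poset P
    module Q = Poset Q
    module Pop₁ = PopOperator P
    module Pop₂ = PopOperator Q
  open Poset (×-poset P Q) using (_≤_)
  open PopOperator (×-poset P Q)

  ⋖-×ˡ : ∀ {y x w} → y Pop₁.⋖ x → (y , w) ⋖ (x , w)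
  ⋖-×ˡ ((y≤x , y≉x) , no-middle) =
    ((y≤x , Q.refl) , y≉x ∘ proj₁) ,
    λ ((u , v) , ((y≤u , w≤v) , y,w≉u,v) , ((u≤x , v≤w) , u,v≉x,w)) →
      let w≈v = Q.antisym w≤v v≤w in
      no-middle (u , (y≤u , λ y≈u → y,w≉u,v (y≈u , w≈v)) , (u≤x , λ u≈x → u,v≉x,w (u≈x , Q.Eq.sym w≈v)))

  ⋖-×ʳ : ∀ {x y w} → y Pop₂.⋖ w → (x , y) ⋖ (x , w)
  ⋖-×ʳ ((y≤w , y≉w) , no-middle) =
    ((P.refl , y≤w) , y≉w ∘ proj₂) ,
    λ ((u , v) , ((x≤u , y≤v) , x,y≉u,v) , ((u≤x , v≤w) , u,v≉x,w)) →
      let x≈u = P.antisym x≤u u≤x in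
      no-middle (v , (y≤v , λ y≈v → x,y≉u,v (x≈u , y≈v)) , (v≤w , λ v≈w → u,v≉x,w (P.Eq.sym x≈u , v≈w)))

  ⋖-×⁻ : ∀ {y₁ y₂ x w} → (y₁ , y₂) ⋖ (x , w) →
         (y₁ Pop₁.⋖ x × y₂ Q.≈ w) ⊎ (y₁ P.≈ x × y₂ Pop₂.⋖ w)
  ⋖-×⁻ {y₁} {y₂} {x} {w} (((y₁≤x , y₂≤w) , y≉x) , no-middle) with y₁ ≟₁ x | y₂ ≟₂ w
  ... | yes y₁≈x | _ =
    inj₂ (y₁≈x , (y₂≤w , λ y₂≈w → y≉x (y₁≈x , y₂≈w)) ,
      λ (v , (y₂≤v , y₂≉v) , (v≤w , v≉w)) →
        no-middle ((x , v) , ((y₁≤x , y₂≤v) , y₂≉v ∘ proj₂) , ((P.refl , v≤w) , v≉w ∘ proj₂)))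
  ... | no y₁≉x | yes y₂≈w =
    inj₁ (((y₁≤x , y₁≉x) ,
      λ (u , (y₁≤u , y₁≉u) , (u≤x , u≉x)) →
        no-middle ((u , w) , ((y₁≤u , y₂≤w) , y₁≉u ∘ proj₁) , ((u≤x , Q.refl) , u≉x ∘ proj₁))) , y₂≈w)
  ... | no y₁≉x | no y₂≉w =
    ⊥-elim (no-middle ((y₁ , w) , ((P.refl , y₂≤w) , y₂≉w ∘ proj₂) , ((y₁≤x , Q.refl) , y₁≉x ∘ proj₁)))

  LowerBound-×⇔ : ∀ {x w q₁ q₂} →
    LowerBound (x , w) (q₁ , q₂) ⇔ (Pop₁.LowerBound x q₁ × Pop₂.LowerBound w q₂)
  LowerBound-×⇔ {x} {w} {q₁} {q₂} = mk⇔
    (λ ((q₁≤x , q₂≤w) , q≤covers) →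
      (q₁≤x , λ y y⋖x → proj₁ (q≤covers (y , w) (⋖-×ˡ y⋖x))) ,
      (q₂≤w , λ y y⋖w → proj₂ (q≤covers (x , y) (⋖-×ʳ y⋖w))))
    (λ ((q₁≤x , q₁≤covers) , (q₂≤w , q₂≤covers)) →
      (q₁≤x , q₂≤w) ,
      λ (y₁ , y₂) y⋖x,w → below-cover q₁≤x q₁≤covers q₂≤w q₂≤covers (⋖-×⁻ y⋖x,w))
    where
    below-cover : ∀ {y₁ y₂} → q₁ P.≤ x → (∀ y → y Pop₁.⋖ x → q₁ P.≤ y) →
                  q₂ Q.≤ w → (∀ y → y Pop₂.⋖ w → q₂ Q.≤ y) →
                  (y₁ Pop₁.⋖ x × y₂ Q.≈ w) ⊎ (y₁ P.≈ x × y₂ Pop₂.⋖ w) → (q₁ , q₂) ≤ (y₁ , y₂)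
    below-cover _ q₁≤covers q₂≤w _ (inj₁ (y₁⋖x , y₂≈w)) =
      q₁≤covers _ y₁⋖x , Q.≤-respʳ-≈ (Q.Eq.sym y₂≈w) q₂≤w
    below-cover q₁≤x _ _ q₂≤covers (inj₂ (y₁≈x , y₂⋖w)) =
      P.≤-respʳ-≈ (P.Eq.sym y₁≈x) q₁≤x , q₂≤covers _ y₂⋖w

  IsPop-×⇔ : ∀ {x w z₁ z₂} → IsPop (x , w) (z₁ , z₂) ⇔ (Pop₁.IsPop x z₁ × Pop₂.IsPop w z₂)
  IsPop-×⇔ = mk⇔
    (λ pop@(lb , _) → let (lb₁ , lb₂) = to LowerBound-×⇔ lb in
      (lb₁ , λ q q≤x q≤covers → proj₁ (IsPop-greatest pop (from LowerBound-×⇔ ((q≤x , q≤covers) , lb₂)))) ,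
      (lb₂ , λ q q≤w q≤covers → proj₂ (IsPop-greatest pop (from LowerBound-×⇔ (lb₁ , (q≤w , q≤covers))))))
    (λ (pop₁@(lb₁ , _) , pop₂@(lb₂ , _)) →
      from LowerBound-×⇔ (lb₁ , lb₂) ,
      λ (q₁ , q₂) q≤x,w q≤covers → let (lbq₁ , lbq₂) = to LowerBound-×⇔ (q≤x,w , q≤covers) in
        Pop₁.IsPop-greatest pop₁ lbq₁ , Pop₂.IsPop-greatest pop₂ lbq₂)

  Sortable-×⇔ : ∀ t {x w} → Sortable t (x , w) ⇔ (Pop₁.Sortable t x × Pop₂.Sortable t w)
  Sortable-×⇔ zero {x} {w} = mk⇔
    (λ min → (λ y → proj₁ (min (y , w))) , (λ y → proj₂ (min (x , y))))
    (λ (min₁ , min₂) (y₁ , y₂) → min₁ y₁ , min₂ y₂)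
  Sortable-×⇔ (suc t) = mk⇔
    (λ ((z₁ , z₂) , pop , s) → let (pop₁ , pop₂) = to IsPop-×⇔ pop
                                   (s₁ , s₂) = to (Sortable-×⇔ t) s in
      (z₁ , pop₁ , s₁) , (z₂ , pop₂ , s₂))
    (λ ((z₁ , pop₁ , s₁) , (z₂ , pop₂ , s₂)) →
      (z₁ , z₂) , from IsPop-×⇔ (pop₁ , pop₂) , from (Sortable-×⇔ t) (s₁ , s₂))

module PopEmbedding {c ℓ} (P R : Poset c ℓ ℓ) (f : Poset.Carrier P → Poset.Carrier R)
  (mono : ∀ x y → Poset._≤_ P x y → Poset._≤_ R (f x) (f y))
  (cancel : ∀ x y → Poset._≤_ R (f x) (f y) → Poset._≤_ P x y)
  (image-downward-closed : ∀ Y x → Poset._≤_ R Y (f x) → ∃ λ y → Poset._≈_ R Y (f y))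
  (R-bounded : ∃ (Minimum (Poset._≤_ R))) where
  private
    module P = Poset P
    module R = Poset R
    module Popᴾ = PopOperator P
  open PopOperator R

  cong-f : ∀ {x y} → x P.≈ y → f x R.≈ f y
  cong-f x≈y = R.antisym (mono _ _ (P.reflexive x≈y)) (mono _ _ (P.reflexive (P.Eq.sym x≈y)))

  injective-f : ∀ {x y} → f x R.≈ f y → x P.≈ y
  injective-f fx≈fy = P.antisym (cancel _ _ (R.reflexive fx≈fy)) (cancel _ _ (R.reflexive (R.Eq.sym fx≈fy)))

  ⋖-f : ∀ {y x} → y Popᴾ.⋖ x → f y ⋖ f x
  ⋖-f ((y≤x , y≉x) , no-middle) =
    (mono _ _ y≤x , y≉x ∘ injective-f) ,
    λ (U , (fy≤U , fy≉U) , (U≤fx , U≉fx)) →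
      let (u , U≈fu) = image-downward-closed _ _ U≤fx in
      no-middle (u , (cancel _ _ (R.≤-respʳ-≈ U≈fu fy≤U) ,
                      λ y≈u → fy≉U (R.Eq.trans (cong-f y≈u) (R.Eq.sym U≈fu))) ,
                     (cancel _ _ (R.≤-respˡ-≈ U≈fu U≤fx) ,
                      λ u≈x → U≉fx (R.Eq.trans U≈fu (cong-f u≈x))))

  ⋖-f⁻ : ∀ {Y y x} → Y ⋖ f x → Y R.≈ f y → y Popᴾ.⋖ x
  ⋖-f⁻ Y⋖fx Y≈fy with ⋖-respˡ-≈ Y≈fy Y⋖fx
  ... | ((fy≤fx , fy≉fx) , no-middle) =
    (cancel _ _ fy≤fx , fy≉fx ∘ cong-f) ,
    λ (u , (y≤u , y≉u) , (u≤x , u≉x)) →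
      no-middle (f u , (mono _ _ y≤u , y≉u ∘ injective-f) , (mono _ _ u≤x , u≉x ∘ injective-f))

  LowerBound-f⇔ : ∀ {x q} → LowerBound (f x) (f q) ⇔ Popᴾ.LowerBound x q
  LowerBound-f⇔ = mk⇔
    (λ (fq≤fx , fq≤covers) → cancel _ _ fq≤fx , λ y y⋖x → cancel _ _ (fq≤covers (f y) (⋖-f y⋖x)))
    (λ (q≤x , q≤covers) → mono _ _ q≤x , λ Y Y⋖fx →
      let (y , Y≈fy) = image-downward-closed _ _ (proj₁ (proj₁ Y⋖fx)) in
      R.≤-respʳ-≈ (R.Eq.sym Y≈fy) (mono _ _ (q≤covers y (⋖-f⁻ Y⋖fx Y≈fy))))

  IsPop-f⇔ : ∀ {x z} → IsPop (f x) (f z) ⇔ Popᴾ.IsPop x z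
  IsPop-f⇔ = mk⇔
    (λ pop@(lb , _) → to LowerBound-f⇔ lb ,
      λ q q≤x q≤covers → cancel _ _ (IsPop-greatest pop (from LowerBound-f⇔ (q≤x , q≤covers))))
    (λ pop@(lb , _) → from LowerBound-f⇔ lb ,
      λ Q Q≤fx Q≤covers →
        let (q , Q≈fq) = image-downward-closed _ _ Q≤fx in
        R.≤-respˡ-≈ (R.Eq.sym Q≈fq) (mono _ _ (Popᴾ.IsPop-greatest pop
          (to LowerBound-f⇔ (LowerBound-resp-≈ R.Eq.refl Q≈fq (Q≤fx , Q≤covers))))))

  Minimum-f⇔ : ∀ {x} → Minimum R._≤_ (f x) ⇔ Minimum P._≤_ x
  Minimum-f⇔ {x} = mk⇔
    (λ min y → cancel _ _ (min (f y)))
    (λ min Y → let (⊥ , ⊥-min) = R-bounded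
                   (b , ⊥≈fb) = image-downward-closed _ _ (⊥-min (f x)) in
      R.trans (mono _ _ (min b)) (R.trans (R.reflexive (R.Eq.sym ⊥≈fb)) (⊥-min Y)))

  Sortable-f⇔ : ∀ t {x} → Sortable t (f x) ⇔ Popᴾ.Sortable t x
  Sortable-f⇔ zero = Minimum-f⇔
  Sortable-f⇔ (suc t) = mk⇔
    (λ (Z , pop , s) →
      let (z , Z≈fz) = image-downward-closed _ _ (proj₁ (proj₁ pop)) in
      z , to IsPop-f⇔ (IsPop-resp-≈ R.Eq.refl Z≈fz pop) , to (Sortable-f⇔ t) (Sortable-resp-≈ t Z≈fz s))
    (λ (z , pop , s) → f z , from IsPop-f⇔ pop , from (Sortable-f⇔ t) s)

-- The lattice V m

-- Data.Nat's _≤_ and _<_ would clash with the poset relations above.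
open import Data.Nat using (_+_; _*_; _∸_; _≤_; _<_; z≤n; s≤s; _<?_; _≟_)
open import Data.Nat.Properties
open import Data.Nat.Induction using (<-rec)
open import Data.List using (List; []; _∷_; _++_; map; length; foldl; take; drop)
open import Data.List.Properties
  using (length-++; length-map; length-take; length-drop; map-++; map-cong; map-∘; ++-assoc; ++-identityʳ; map-id; ≡-dec)
open import Data.List.Relation.Unary.All using (All; []; _∷_)
open import Relation.Binary.PropositionalEquality
open import Defs

!-++ˡ : ∀ (xs ys : List ℕ) {i} → i < length xs → (xs ++ ys) ! i ≡ xs ! i
!-++ˡ (x ∷ xs) ys {zero}  _         = refl
!-++ˡ (x ∷ xs) ys {suc i} (s≤s i<n) = !-++ˡ xs ys i<n

!-++ʳ : ∀ (xs ys : List ℕ) j → (xs ++ ys) ! (length xs + j) ≡ ys ! j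
!-++ʳ []       ys j = refl
!-++ʳ (x ∷ xs) ys j = !-++ʳ xs ys j

!-map : ∀ (f : ℕ → ℕ) xs {j} → j < length xs → map f xs ! j ≡ f (xs ! j)
!-map f (x ∷ xs) {zero}  _         = refl
!-map f (x ∷ xs) {suc j} (s≤s j<n) = !-map f xs j<n

!-take : ∀ n (xs : List ℕ) {i} → i < n → take n xs ! i ≡ xs ! i
!-take (suc n) []       _                 = refl
!-take (suc n) (x ∷ xs) {zero}  _         = refl
!-take (suc n) (x ∷ xs) {suc i} (s≤s i<n) = !-take n xs i<n

!-drop : ∀ n (xs : List ℕ) j → drop n xs ! j ≡ xs ! (n + j)
!-drop zero    xs       j = refl
!-drop (suc n) []       j = refl
!-drop (suc n) (x ∷ xs) j = !-drop n xs j

!-ext : ∀ {xs ys : List ℕ} → length xs ≡ length ys →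
        (∀ {i} → i < length xs → xs ! i ≡ ys ! i) → xs ≡ ys
!-ext {[]}     {[]}     _   _  = refl
!-ext {x ∷ xs} {y ∷ ys} len eq = cong₂ _∷_ (eq (s≤s z≤n)) (!-ext (suc-injective len) (eq ∘ s≤s))

even⊎odd : ∀ i → (∃ λ k → i ≡ 2 * k) ⊎ (∃ λ k → i ≡ 1 + 2 * k)
even⊎odd zero = inj₁ (0 , refl)
even⊎odd (suc i) with even⊎odd i
... | inj₁ (k , refl) = inj₂ (k , refl)
... | inj₂ (k , refl) = inj₁ (suc k , cong suc (sym (+-suc k (k + 0))))

<⊎offset : ∀ m i → i < m ⊎ ∃ λ j → i ≡ m + j
<⊎offset m i with i <? m
... | yes i<m = inj₁ i<m
... | no  i≮m = inj₂ (i ∸ m , sym (m+[n∸m]≡n (≮⇒≥ i≮m)))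

2*-distrib : ∀ a b → 2 * (a + b) ≡ 2 * a + 2 * b
2*-distrib = *-distribˡ-+ 2

1+2*-distrib : ∀ a b → 1 + 2 * (a + b) ≡ 2 * a + (1 + 2 * b)
1+2*-distrib a b = trans (cong suc (2*-distrib a b)) (sym (+-suc (2 * a) (2 * b)))

2*-mono-< : ∀ {k m} → k < m → 2 * k < 2 * m
2*-mono-< = *-monoʳ-< 2

1+2*-mono-< : ∀ {k m} → k < m → 1 + 2 * k < 2 * m
1+2*-mono-< {k} k<m = ≤-trans (s≤s (≤-reflexive (sym (+-suc k (k + 0))))) (*-monoʳ-≤ 2 k<m)

2*-cancel-< : ∀ {k m} → 2 * k < 2 * m → k < m
2*-cancel-< {k} {m} = *-cancelˡ-< 2 k m

1+2*-cancel-< : ∀ {k m} → 1 + 2 * k < 2 * m → k < m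
1+2*-cancel-< {k} 1+2k<2m = 2*-cancel-< (<-trans (n<1+n (2 * k)) 1+2k<2m)

2*-offset-< : ∀ m₁ m₂ {j} → j < 2 * m₂ → 2 * m₁ + j < 2 * (m₁ + m₂)
2*-offset-< m₁ m₂ {j} j<2m₂ = subst (2 * m₁ + j <_) (sym (2*-distrib m₁ m₂)) (+-monoʳ-< (2 * m₁) j<2m₂)

2*-offset-cancel-< : ∀ m₁ m₂ {j} → 2 * m₁ + j < 2 * (m₁ + m₂) → j < 2 * m₂
2*-offset-cancel-< m₁ m₂ {j} i<2m = +-cancelˡ-< (2 * m₁) j (2 * m₂) (subst (2 * m₁ + j <_) (2*-distrib m₁ m₂) i<2m)

2*m≤2*[m+n] : ∀ m₁ m₂ → 2 * m₁ ≤ 2 * (m₁ + m₂)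
2*m≤2*[m+n] m₁ m₂ = *-monoʳ-≤ 2 (m≤m+n m₁ m₂)

<⇒≤∸1 : ∀ {v m} → v < m → v ≤ m ∸ 1
<⇒≤∸1 {m = suc m} (s≤s v≤m) = v≤m

≤∸1⇒< : ∀ {k v m} → k < m → v ≤ m ∸ 1 → v < m
≤∸1⇒< {m = suc m} _ v≤m = s≤s v≤m

length-plus : ∀ m₁ a b → length (plus m₁ a b) ≡ length a + length b
length-plus m₁ a b = trans (length-++ a) (cong (length a +_) (length-map (m₁ +_) b))

plus-!ˡ : ∀ m₁ a b {i} → length a ≡ 2 * m₁ → i < 2 * m₁ → plus m₁ a b ! i ≡ a ! i
plus-!ˡ m₁ a b len i<2m₁ = !-++ˡ a _ (subst (_ <_) (sym len) i<2m₁)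

plus-!ʳ : ∀ m₁ a b {j} → length a ≡ 2 * m₁ → j < length b → plus m₁ a b ! (2 * m₁ + j) ≡ m₁ + b ! j
plus-!ʳ m₁ a b {j} len j<len =
  subst (λ n → plus m₁ a b ! (n + j) ≡ m₁ + b ! j) len (trans (!-++ʳ a (map (m₁ +_) b) j) (!-map (m₁ +_) b j<len))

plus-assoc : ∀ m m₁ a b c → plus (m + m₁) (plus m a b) c ≡ plus m a (plus m₁ b c)
plus-assoc m m₁ a b c = begin
  (a ++ map (m +_) b) ++ map (m + m₁ +_) c
    ≡⟨ ++-assoc a (map (m +_) b) _ ⟩
  a ++ (map (m +_) b ++ map (m + m₁ +_) c)
    ≡⟨ cong (λ d → a ++ (map (m +_) b ++ d)) (trans (map-cong (+-assoc m m₁) c) (map-∘ c)) ⟩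
  a ++ (map (m +_) b ++ map (m +_) (map (m₁ +_) c))
    ≡⟨ cong (a ++_) (sym (map-++ (m +_) b (map (m₁ +_) c))) ⟩
  a ++ map (m +_) (b ++ map (m₁ +_) c)
    ∎
  where open ≡-Reasoning

open IsV

IsV-entry< : ∀ {m b} → IsV m b → ∀ {i} → i < 2 * m → b ! i < m
IsV-entry< {m} pb {i} i<2m with even⊎odd i
... | inj₁ (k , refl) = ≤∸1⇒< (2*-cancel-< {k} i<2m) (evenHi pb k (2*-cancel-< i<2m))
... | inj₂ (k , refl) = subst (_< m) (sym (odd pb k (1+2*-cancel-< i<2m))) (1+2*-cancel-< i<2m)

IsV-entry≥ : ∀ {m₁ m₂ b} → IsV (m₁ + m₂) b → ∀ {j} → j < 2 * m₂ → m₁ ≤ b ! (2 * m₁ + j)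
IsV-entry≥ {m₁} {b = b} pb {j} j<2m₂ with even⊎odd j
... | inj₁ (k , refl) = ≤-trans (m≤m+n m₁ k)
  (subst (λ i → m₁ + k ≤ b ! i) (2*-distrib m₁ k) (evenLo pb (m₁ + k) (+-monoʳ-< m₁ (2*-cancel-< j<2m₂))))
... | inj₂ (k , refl) = ≤-trans (m≤m+n m₁ k) (≤-reflexive (sym
  (subst (λ i → b ! i ≡ m₁ + k) (1+2*-distrib m₁ k) (odd pb (m₁ + k) (+-monoʳ-< m₁ (1+2*-cancel-< j<2m₂))))))

module _ {m₁ m₂ a b} (pa : IsV m₁ a) (pb : IsV m₂ b) where
  private
    ab = plus m₁ a b

    ab-!ˡ : ∀ {i} → i < 2 * m₁ → ab ! i ≡ a ! i
    ab-!ˡ = plus-!ˡ m₁ a b (len pa)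

    ab-!ʳ : ∀ {j} → j < 2 * m₂ → ab ! (2 * m₁ + j) ≡ m₁ + b ! j
    ab-!ʳ j<2m₂ = plus-!ʳ m₁ a b (len pa) (subst (_ <_) (sym (len pb)) j<2m₂)

    ab-entry< : ∀ {i} → i < 2 * (m₁ + m₂) → ab ! i < m₁ + m₂
    ab-entry< {i} i<2m with <⊎offset (2 * m₁) i
    ... | inj₁ i<2m₁ = subst (_< m₁ + m₂) (sym (ab-!ˡ i<2m₁)) (<-≤-trans (IsV-entry< pa i<2m₁) (m≤m+n m₁ m₂))
    ... | inj₂ (j , refl) = subst (_< m₁ + m₂) (sym (ab-!ʳ j<2m₂)) (+-monoʳ-< m₁ (IsV-entry< pb j<2m₂))
      where j<2m₂ = 2*-offset-cancel-< m₁ m₂ i<2m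

  IsV-plus : IsV (m₁ + m₂) ab
  len IsV-plus = trans (length-plus m₁ a b) (trans (cong₂ _+_ (len pa) (len pb)) (sym (2*-distrib m₁ m₂)))
  odd IsV-plus k k<m with <⊎offset m₁ k
  ... | inj₁ k<m₁ = trans (ab-!ˡ (1+2*-mono-< k<m₁)) (odd pa k k<m₁)
  ... | inj₂ (k' , refl) = begin
    ab ! (1 + 2 * (m₁ + k'))   ≡⟨ cong (ab !_) (1+2*-distrib m₁ k') ⟩
    ab ! (2 * m₁ + (1 + 2 * k')) ≡⟨ ab-!ʳ (1+2*-mono-< k'<m₂) ⟩
    m₁ + b ! (1 + 2 * k')       ≡⟨ cong (m₁ +_) (odd pb k' k'<m₂) ⟩
    m₁ + k'                     ∎
    where open ≡-Reasoning
          k'<m₂ = +-cancelˡ-< m₁ k' m₂ k<m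
  evenLo IsV-plus k k<m with <⊎offset m₁ k
  ... | inj₁ k<m₁ = subst (k ≤_) (sym (ab-!ˡ (2*-mono-< k<m₁))) (evenLo pa k k<m₁)
  ... | inj₂ (k' , refl) =
    subst (m₁ + k' ≤_) (sym (trans (cong (ab !_) (2*-distrib m₁ k')) (ab-!ʳ (2*-mono-< k'<m₂))))
      (+-monoʳ-≤ m₁ (evenLo pb k' k'<m₂))
    where k'<m₂ = +-cancelˡ-< m₁ k' m₂ k<m
  evenHi IsV-plus k k<m = <⇒≤∸1 (ab-entry< (2*-mono-< k<m))
  nest IsV-plus i j i<2m i<j j≤1+2abᵢ with <⊎offset (2 * m₁) i
  ... | inj₁ i<2m₁ =
    subst₂ _≤_ (sym (ab-!ˡ j<2m₁)) (sym (ab-!ˡ i<2m₁)) (nest pa i j i<2m₁ i<j j≤1+2aᵢ)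
    where j≤1+2aᵢ = subst (λ v → j ≤ 1 + 2 * v) (ab-!ˡ i<2m₁) j≤1+2abᵢ
          j<2m₁ = ≤-<-trans j≤1+2aᵢ (1+2*-mono-< (IsV-entry< pa i<2m₁))
  ... | inj₂ (i' , refl) with <⊎offset (2 * m₁) j
  ...   | inj₁ j<2m₁ = ⊥-elim (<-irrefl refl (<-trans (≤-<-trans (m≤m+n (2 * m₁) i') i<j) j<2m₁))
  ...   | inj₂ (j' , refl) =
    subst₂ _≤_ (sym (ab-!ʳ j'<2m₂)) (sym (ab-!ʳ i'<2m₂)) (+-monoʳ-≤ m₁ (nest pb i' j' i'<2m₂ i'<j' j'≤1+2bᵢ))
    where i'<2m₂ = 2*-offset-cancel-< m₁ m₂ i<2m
          i'<j' = +-cancelˡ-≤ (2 * m₁) (suc i') j' (subst (_≤ 2 * m₁ + j') (sym (+-suc (2 * m₁) i')) i<j)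
          j'≤1+2bᵢ = +-cancelˡ-≤ (2 * m₁) j' (1 + 2 * (b ! i'))
            (subst (2 * m₁ + j' ≤_)
              (trans (cong (λ v → 1 + 2 * v) (ab-!ʳ i'<2m₂)) (1+2*-distrib m₁ (b ! i'))) j≤1+2abᵢ)
          j'<2m₂ = ≤-<-trans j'≤1+2bᵢ (1+2*-mono-< (IsV-entry< pb i'<2m₂))

module _ {m₁ m₂ y} (py : IsV (m₁ + m₂) y) (head-small : ∀ {k} → k < m₁ → y ! (2 * k) < m₁) where
  private
    head = take (2 * m₁) y
    tail = map (_∸ m₁) (drop (2 * m₁) y)

    length-y : length y ≡ 2 * m₁ + 2 * m₂
    length-y = trans (len py) (2*-distrib m₁ m₂)

    length-head : length head ≡ 2 * m₁
    length-head = trans (length-take (2 * m₁) y) (m≤n⇒m⊓n≡m (subst (2 * m₁ ≤_) (sym length-y) (m≤m+n _ _)))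

    length-dropped : length (drop (2 * m₁) y) ≡ 2 * m₂
    length-dropped = trans (length-drop (2 * m₁) y) (trans (cong (_∸ 2 * m₁) length-y) (m+n∸m≡n (2 * m₁) (2 * m₂)))

    length-tail : length tail ≡ 2 * m₂
    length-tail = trans (length-map (_∸ m₁) (drop (2 * m₁) y)) length-dropped

    head-! : ∀ {i} → i < 2 * m₁ → head ! i ≡ y ! i
    head-! = !-take (2 * m₁) y

    tail-! : ∀ {j} → j < 2 * m₂ → m₁ + tail ! j ≡ y ! (2 * m₁ + j)
    tail-! {j} j<2m₂ = begin
      m₁ + tail ! j
        ≡⟨ cong (m₁ +_) (!-map (_∸ m₁) (drop (2 * m₁) y) (subst (j <_) (sym length-dropped) j<2m₂)) ⟩
      m₁ + (drop (2 * m₁) y ! j ∸ m₁) ≡⟨ cong (λ v → m₁ + (v ∸ m₁)) (!-drop (2 * m₁) y j) ⟩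
      m₁ + (y ! (2 * m₁ + j) ∸ m₁)    ≡⟨ m+[n∸m]≡n (IsV-entry≥ {m₁} {m₂} py j<2m₂) ⟩
      y ! (2 * m₁ + j)                ∎
      where open ≡-Reasoning

    head-entry< : ∀ {i} → i < 2 * m₁ → y ! i < m₁
    head-entry< {i} i<2m₁ with even⊎odd i
    ... | inj₁ (k , refl) = head-small (2*-cancel-< {k} i<2m₁)
    ... | inj₂ (k , refl) = subst (_< m₁) (sym (odd py k (<-≤-trans k<m₁ (m≤m+n m₁ m₂)))) k<m₁
      where k<m₁ = 1+2*-cancel-< i<2m₁

    tail-entry< : ∀ {j} → j < 2 * m₂ → tail ! j < m₂
    tail-entry< j<2m₂ = +-cancelˡ-< m₁ _ m₂
      (subst (_< m₁ + m₂) (sym (tail-! j<2m₂)) (IsV-entry< py (2*-offset-< m₁ m₂ j<2m₂)))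

    IsV-head : IsV m₁ head
    len IsV-head = length-head
    odd IsV-head k k<m₁ = trans (head-! (1+2*-mono-< k<m₁)) (odd py k (<-≤-trans k<m₁ (m≤m+n m₁ m₂)))
    evenLo IsV-head k k<m₁ =
      subst (k ≤_) (sym (head-! (2*-mono-< k<m₁))) (evenLo py k (<-≤-trans k<m₁ (m≤m+n m₁ m₂)))
    evenHi IsV-head k k<m₁ = <⇒≤∸1 (subst (_< m₁) (sym (head-! (2*-mono-< k<m₁))) (head-small k<m₁))
    nest IsV-head i j i<2m₁ i<j j≤1+2hᵢ =
      subst₂ _≤_ (sym (head-! j<2m₁)) (sym (head-! i<2m₁))
        (nest py i j (<-≤-trans i<2m₁ (2*m≤2*[m+n] m₁ m₂)) i<j j≤1+2yᵢ)
      where j≤1+2yᵢ = subst (λ v → j ≤ 1 + 2 * v) (head-! i<2m₁) j≤1+2hᵢ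
            j<2m₁ = ≤-<-trans j≤1+2yᵢ (1+2*-mono-< (head-entry< i<2m₁))

    IsV-tail : IsV m₂ tail
    len IsV-tail = length-tail
    odd IsV-tail k k<m₂ = +-cancelˡ-≡ m₁ _ _ (begin
      m₁ + tail ! (1 + 2 * k)    ≡⟨ tail-! (1+2*-mono-< k<m₂) ⟩
      y ! (2 * m₁ + (1 + 2 * k)) ≡⟨ cong (y !_) (sym (1+2*-distrib m₁ k)) ⟩
      y ! (1 + 2 * (m₁ + k))     ≡⟨ odd py (m₁ + k) (+-monoʳ-< m₁ k<m₂) ⟩
      m₁ + k                     ∎)
      where open ≡-Reasoning
    evenLo IsV-tail k k<m₂ = +-cancelˡ-≤ m₁ k _
      (subst (m₁ + k ≤_) (trans (cong (y !_) (2*-distrib m₁ k)) (sym (tail-! (2*-mono-< k<m₂))))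
        (evenLo py (m₁ + k) (+-monoʳ-< m₁ k<m₂)))
    evenHi IsV-tail k k<m₂ = <⇒≤∸1 (tail-entry< (2*-mono-< k<m₂))
    nest IsV-tail i j i<2m₂ i<j j≤1+2tᵢ = +-cancelˡ-≤ m₁ _ _
      (subst₂ _≤_ (sym (tail-! j<2m₂)) (sym (tail-! i<2m₂))
        (nest py (2 * m₁ + i) (2 * m₁ + j) (2*-offset-< m₁ m₂ i<2m₂) shifted-i<j shifted-j≤))
      where
      j<2m₂ = ≤-<-trans j≤1+2tᵢ (1+2*-mono-< (tail-entry< i<2m₂))
      shifted-i<j : 1 + (2 * m₁ + i) ≤ 2 * m₁ + j
      shifted-i<j = subst (_≤ 2 * m₁ + j) (+-suc (2 * m₁) i) (+-monoʳ-≤ (2 * m₁) i<j)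
      shifted-j≤ : 2 * m₁ + j ≤ 1 + 2 * (y ! (2 * m₁ + i))
      shifted-j≤ = subst (2 * m₁ + j ≤_)
        (trans (sym (1+2*-distrib m₁ (tail ! i))) (cong (λ v → 1 + 2 * v) (tail-! i<2m₂)))
        (+-monoʳ-≤ (2 * m₁) j≤1+2tᵢ)

    y≡head⊕tail : y ≡ plus m₁ head tail
    y≡head⊕tail = !-ext
      (trans length-y (sym (trans (length-plus m₁ head tail) (cong₂ _+_ length-head length-tail))))
      entry
      where
      entry : ∀ {i} → i < length y → y ! i ≡ plus m₁ head tail ! i
      entry {i} i<len with <⊎offset (2 * m₁) i
      ... | inj₁ i<2m₁ = sym (trans (plus-!ˡ m₁ head tail length-head i<2m₁) (head-! i<2m₁))
      ... | inj₂ (j , refl) =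
        sym (trans (plus-!ʳ m₁ head tail length-head (subst (j <_) (sym length-tail) j<2m₂)) (tail-! j<2m₂))
        where j<2m₂ = +-cancelˡ-< (2 * m₁) j (2 * m₂) (subst (2 * m₁ + j <_) length-y i<len)

  split : ∃₂ λ (y₁ : V m₁) (y₂ : V m₂) → y ≡ plus m₁ (proj₁ y₁) (proj₁ y₂)
  split = (head , IsV-head) , (tail , IsV-tail) , y≡head⊕tail

V-poset : ℕ → Poset 0ℓ 0ℓ 0ℓ
V-poset m = record
  { Carrier        = V m
  ; _≈_            = λ x y → proj₁ x ≡ proj₁ y
  ; _≤_            = _≼_
  ; isPartialOrder = record
    { isPreorder = record
      { isEquivalence = record { refl = refl ; sym = sym ; trans = trans }
      ; reflexive     = λ x≡y i _ → ≤-reflexive (cong (_! i) x≡y)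
      ; trans         = λ x≼y y≼z i i<2m → ≤-trans (x≼y i i<2m) (y≼z i i<2m)
      }
    ; antisym = λ {x} {y} x≼y y≼x →
        !-ext (trans (len (proj₂ x)) (sym (len (proj₂ y))))
              (λ {i} i<len → let i<2m = subst (i <_) (len (proj₂ x)) i<len in
                             ≤-antisym (x≼y i i<2m) (y≼x i i<2m))
    }
  }

_≟ᵥ_ : ∀ {m} → Decidable (Poset._≈_ (V-poset m))
x ≟ᵥ y = ≡-dec _≟_ (proj₁ x) (proj₁ y)

module PopV (m : ℕ) = PopOperator (V-poset m)

-- Defs.IsPop m is PopV.IsPop m by definition; only the iteration is restated.

PopSortable⇔Sortable : ∀ m t {x} → PopSortable m t x ⇔ PopV.Sortable m t x
PopSortable⇔Sortable m zero {x} = mk⇔ (λ { (_ , refl , min) → min }) (λ min → x , refl , min)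
PopSortable⇔Sortable m (suc t) = mk⇔
  (λ (y , (z , pop , iter) , min) → z , pop , to (PopSortable⇔Sortable m t) (y , iter , min))
  (λ (z , pop , s) → let (y , iter , min) = from (PopSortable⇔Sortable m t) s in y , (z , pop , iter) , min)

PopSortable-resp-≡ : ∀ m t {x y : V m} → proj₁ x ≡ proj₁ y → PopSortable m t x → PopSortable m t y
PopSortable-resp-≡ m t x≡y =
  from (PopSortable⇔Sortable m t) ∘ PopV.Sortable-resp-≈ m t x≡y ∘ to (PopSortable⇔Sortable m t)

_⊕_ : ∀ {m₁ m₂} → V m₁ → V m₂ → V (m₁ + m₂)
_⊕_ {m₁} (a , pa) (b , pb) = plus m₁ a b , IsV-plus pa pb

module _ {m₁ m₂ : ℕ} where
  ⊕-!ˡ : ∀ (x : V m₁) (w : V m₂) {i} → i < 2 * m₁ → proj₁ (x ⊕ w) ! i ≡ proj₁ x ! i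
  ⊕-!ˡ (a , pa) (b , _) = plus-!ˡ m₁ a b (len pa)

  ⊕-!ʳ : ∀ (x : V m₁) (w : V m₂) {j} → j < 2 * m₂ → proj₁ (x ⊕ w) ! (2 * m₁ + j) ≡ m₁ + proj₁ w ! j
  ⊕-!ʳ (a , pa) (b , pb) j<2m₂ = plus-!ʳ m₁ a b (len pa) (subst (_ <_) (sym (len pb)) j<2m₂)

  ⊕-mono : ∀ (x y : V m₁ × V m₂) →
           proj₁ x ≼ proj₁ y × proj₂ x ≼ proj₂ y → uncurry _⊕_ x ≼ uncurry _⊕_ y
  ⊕-mono (x₁ , x₂) (y₁ , y₂) (x₁≼y₁ , x₂≼y₂) i i<2m with <⊎offset (2 * m₁) i
  ... | inj₁ i<2m₁ = subst₂ _≤_ (sym (⊕-!ˡ x₁ x₂ i<2m₁)) (sym (⊕-!ˡ y₁ y₂ i<2m₁)) (x₁≼y₁ i i<2m₁)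
  ... | inj₂ (j , refl) =
    subst₂ _≤_ (sym (⊕-!ʳ x₁ x₂ j<2m₂)) (sym (⊕-!ʳ y₁ y₂ j<2m₂)) (+-monoʳ-≤ m₁ (x₂≼y₂ j j<2m₂))
    where j<2m₂ = 2*-offset-cancel-< m₁ m₂ i<2m

  ⊕-cancel : ∀ (x y : V m₁ × V m₂) →
             uncurry _⊕_ x ≼ uncurry _⊕_ y → proj₁ x ≼ proj₁ y × proj₂ x ≼ proj₂ y
  ⊕-cancel (x₁ , x₂) (y₁ , y₂) x≼y =
    (λ i i<2m₁ → subst₂ _≤_ (⊕-!ˡ x₁ x₂ i<2m₁) (⊕-!ˡ y₁ y₂ i<2m₁)
                   (x≼y i (<-≤-trans i<2m₁ (2*m≤2*[m+n] m₁ m₂)))) ,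
    (λ j j<2m₂ → +-cancelˡ-≤ m₁ _ _
      (subst₂ _≤_ (⊕-!ʳ x₁ x₂ j<2m₂) (⊕-!ʳ y₁ y₂ j<2m₂)
        (x≼y (2 * m₁ + j) (2*-offset-< m₁ m₂ j<2m₂))))

  ⊕-downward-closed : ∀ (y : V (m₁ + m₂)) (x : V m₁ × V m₂) → y ≼ uncurry _⊕_ x →
                      ∃ λ z → proj₁ y ≡ proj₁ (uncurry _⊕_ z)
  ⊕-downward-closed y (x , w) y≼x⊕w =
    let (y₁ , y₂ , y≡y₁⊕y₂) = split (proj₂ y) head-small in (y₁ , y₂) , y≡y₁⊕y₂
    where
    head-small : ∀ {k} → k < m₁ → proj₁ y ! (2 * k) < m₁
    head-small k<m₁ =
      ≤-<-trans (subst (_ ≤_) (⊕-!ˡ x w 2k<2m₁) (y≼x⊕w _ (<-≤-trans 2k<2m₁ (2*m≤2*[m+n] m₁ m₂))))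
                (IsV-entry< (proj₂ x) 2k<2m₁)
      where 2k<2m₁ = 2*-mono-< k<m₁

IsV-[] : IsV 0 []
IsV-[] = record { len = refl ; odd = λ _ () ; evenLo = λ _ () ; evenHi = λ _ () ; nest = λ _ _ () }

IsV-single : IsV 1 (0 ∷ 0 ∷ [])
len    IsV-single = refl
odd    IsV-single zero    _         = refl
odd    IsV-single (suc k) (s≤s ())
evenLo IsV-single zero    _         = z≤n
evenLo IsV-single (suc k) (s≤s ())
evenHi IsV-single zero    _         = z≤n
evenHi IsV-single (suc k) (s≤s ())
nest   IsV-single zero    (suc zero)    _ _ _         = z≤n
nest   IsV-single zero    (suc (suc j)) _ _ (s≤s ())
nest   IsV-single (suc zero) (suc (suc j)) _ (s≤s (s≤s _)) (s≤s ())

stair : ∀ m → V m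
stair zero    = [] , IsV-[]
stair (suc m) = (0 ∷ 0 ∷ [] , IsV-single) ⊕ stair m

stair-even : ∀ m {k} → k < m → proj₁ (stair m) ! (2 * k) ≡ k
stair-even (suc m) {zero}  _         = refl
stair-even (suc m) {suc k} (s≤s k<m) =
  trans (cong (proj₁ (stair (suc m)) !_) (2*-distrib 1 k))
        (trans (⊕-!ʳ (0 ∷ 0 ∷ [] , IsV-single) (stair m) (2*-mono-< k<m)) (cong suc (stair-even m k<m)))

stair-minimum : ∀ m → Minimum _≼_ (stair m)
stair-minimum m y i i<2m with even⊎odd i
... | inj₁ (k , refl) = subst (_≤ _) (sym (stair-even m k<m)) (evenLo (proj₂ y) k k<m)
  where k<m = 2*-cancel-< {k} i<2m
... | inj₂ (k , refl) = ≤-reflexive (trans (odd (proj₂ (stair m)) k k<m) (sym (odd (proj₂ y) k k<m)))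
  where k<m = 1+2*-cancel-< i<2m

PopSortable-⊕⇔ : ∀ {m₁ m₂} t (x : V m₁) (w : V m₂) →
  PopSortable (m₁ + m₂) t (x ⊕ w) ⇔ (PopSortable m₁ t x × PopSortable m₂ t w)
PopSortable-⊕⇔ {m₁} {m₂} t x w =
  ⇔-trans (PopSortable⇔Sortable _ t)
    (⇔-trans (Embedding.Sortable-f⇔ t)
      (⇔-trans (Product.Sortable-×⇔ t) (⇔-sym (PopSortable⇔Sortable m₁ t ×-⇔ PopSortable⇔Sortable m₂ t))))
  where
  module Embedding = PopEmbedding (×-poset (V-poset m₁) (V-poset m₂)) (V-poset (m₁ + m₂)) (uncurry _⊕_)
    ⊕-mono ⊕-cancel ⊕-downward-closed
    (stair (m₁ + m₂) , stair-minimum (m₁ + m₂))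
  module Product = PopProduct (V-poset m₁) (V-poset m₂) _≟ᵥ_ _≟ᵥ_

IrreducibleComponent : Component → Set
IrreducibleComponent c = 1 ≤ proj₁ c × Irreducible (proj₁ c) (proj₂ c)

SortableComponent : ℕ → Component → Set
SortableComponent t c = PopSortable (proj₁ c) t (proj₂ c)

first-block-small : ∀ {k r} → IsV (suc k) r → ∀ {j} → j < suc (r ! 0) → r ! (2 * j) < suc (r ! 0)
first-block-small pr {zero}  _            = n<1+n _
first-block-small pr {suc j} (s≤s 1+j≤r₀) =
  s≤s (nest pr 0 (2 * suc j) (s≤s z≤n) (s≤s z≤n) (≤-trans (*-monoʳ-≤ 2 1+j≤r₀) (n≤1+n _)))

first-block-irreducible : ∀ {v h} (ph : IsV (suc v) h) → h ! 0 ≡ v → Irreducible (suc v) (h , ph)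
first-block-irreducible {v} {h} ph h₀≡v =
  trans h₀≡v (sym (trans (cong (h !_) (+-suc v (v + 0))) (odd ph v (n<1+n v))))

first-block+rest≡ : ∀ {k r} → IsV (suc k) r → suc (r ! 0) + (k ∸ r ! 0) ≡ suc k
first-block+rest≡ pr = m+[n∸m]≡n (IsV-entry< pr (s≤s z≤n))

split-first-block : ∀ {k r} (pr : IsV (suc k) r) →
  ∃₂ λ (h : V (suc (r ! 0))) (t : V (k ∸ r ! 0)) →
    Irreducible _ h × r ≡ plus (suc (r ! 0)) (proj₁ h) (proj₁ t)
split-first-block {r = r} pr =
  let ((h , ph) , t , r≡h⊕t) = split (subst (λ n → IsV n r) (sym (first-block+rest≡ pr)) pr)
                                     (first-block-small pr)
      h₀≡r₀ = trans (sym (plus-!ˡ _ h (proj₁ t) (len ph) (s≤s z≤n))) (cong (_! 0) (sym r≡h⊕t))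
  in (h , ph) , t , first-block-irreducible ph h₀≡r₀ , r≡h⊕t

-- Defs.sumComponents folds a step function local to its definition, so the
-- lemmas below are stated for any function obeying the same equation.
module _ (step : ℕ × List ℕ → Component → ℕ × List ℕ)
         (step-plus : ∀ m acc c → step (m , acc) c ≡ (m + proj₁ c , plus m acc (proj₁ (proj₂ c)))) where

  foldl-PopSortable⇔ : ∀ t cs {m n acc b} (pacc : IsV m acc) (pb : IsV n b) → foldl step (m , acc) cs ≡ (n , b) →
    PopSortable n t (b , pb) ⇔ (PopSortable m t (acc , pacc) × All (SortableComponent t) cs)
  foldl-PopSortable⇔ t [] pacc pb refl =
    mk⇔ (λ s → PopSortable-resp-≡ _ t refl s , []) (λ (s , _) → PopSortable-resp-≡ _ t refl s)
  foldl-PopSortable⇔ t (c@(_ , v) ∷ cs) {m} {acc = acc} pacc pb sum≡b = mk⇔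
    (λ s → let (s-acc⊕v , s-cs) = to rest s
               (s-acc , s-v)   = to (PopSortable-⊕⇔ t (acc , pacc) v) s-acc⊕v in
           s-acc , s-v ∷ s-cs)
    (λ { (s-acc , s-v ∷ s-cs) → from rest (from (PopSortable-⊕⇔ t (acc , pacc) v) (s-acc , s-v) , s-cs) })
    where
    rest = foldl-PopSortable⇔ t cs (proj₂ ((acc , pacc) ⊕ v)) pb
             (subst (λ p → foldl step p cs ≡ _) (step-plus m acc c) sum≡b)

  Decomposable : ℕ → Set
  Decomposable k = ∀ {r} → IsV k r → ∀ m acc →
    ∃ λ cs → All IrreducibleComponent cs × foldl step (m , acc) cs ≡ (m + k , plus m acc r)

  decomposable : ∀ k → Decomposable k
  decomposable = <-rec Decomposable decompose
    where
    decompose : ∀ k → (∀ {j} → j < k → Decomposable j) → Decomposable k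
    decompose zero _ {[]} _ m acc = [] , [] , cong₂ _,_ (sym (+-identityʳ m)) (sym (++-identityʳ acc))
    decompose (suc k) smaller {r} pr m acc =
      let (h , t , h-irreducible , r≡h⊕t) = split-first-block pr
          m₁ = suc (r ! 0)
          (cs , irreducible , sum≡) =
            smaller (s≤s (m∸n≤m k (r ! 0))) (proj₂ t) (m + m₁) (plus m acc (proj₁ h))
      in (m₁ , h) ∷ cs , (s≤s z≤n , h-irreducible) ∷ irreducible , (begin
        foldl step (step (m , acc) (m₁ , h)) cs
          ≡⟨ cong (λ p → foldl step p cs) (step-plus m acc _) ⟩
        foldl step (m + m₁ , plus m acc (proj₁ h)) cs
          ≡⟨ sum≡ ⟩
        (m + m₁ + (k ∸ r ! 0) , plus (m + m₁) (plus m acc (proj₁ h)) (proj₁ t))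
          ≡⟨ cong₂ _,_ (trans (+-assoc m m₁ _) (cong (m +_) (first-block+rest≡ pr)))
                       (trans (plus-assoc m m₁ acc _ _) (cong (plus m acc) (sym r≡h⊕t))) ⟩
        (m + suc k , plus m acc r)
          ∎)
      where open ≡-Reasoning

lemma3p13 : ∀ (n t : ℕ) → 1 ≤ n → (b : V n) →
    Σ (List Component) (IrrDecomposition n b) ×
    (∀ (cs : List Component) → IrrDecomposition n b cs →
    (PopSortable n t b ⇔ All (λ c → PopSortable (proj₁ c) t (proj₂ c)) cs))
lemma3p13 n t _ (b , pb) =
  (cs , irreducible , trans sum≡ (cong (n ,_) (map-id b))) ,
  λ cs (_ , sum≡b) → let sortable⇔ = foldl-PopSortable⇔ _ (λ _ _ _ → refl) t cs IsV-[] pb sum≡b in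
    mk⇔ (proj₂ ∘ to sortable⇔) (λ all → from sortable⇔ (V₀-sortable , all))
  where
  V₀-sortable : PopSortable 0 t ([] , IsV-[])
  V₀-sortable = from (PopSortable⇔Sortable 0 t) (PopV.minimum-Sortable 0 t λ _ _ ())
  decomposition = decomposable _ (λ _ _ _ → refl) n pb 0 []
  cs = proj₁ decomposition
  irreducible = proj₁ (proj₂ decomposition)
  sum≡ = proj₂ (proj₂ decomposition)
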